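{- For every label $X$, every variable $x$, every formula $\varphi$ and every formula $\theta$ in which $x$ does not occur free, the sequent $$X:\neg\theta\to\bar\exists x\,\varphi\Rightarrow X:\bar\exists x(\neg\theta\to\varphi)$$ is derivable in $\mathbf{G}(\mathsf{FBInqBQ})$.
   Context: Language: countably infinite set of variables, countably infinite set of predicate symbols with arities (no identity, constants, function symbols). Formulas: $\varphi ::= P(x_1,\dots,x_m)\mid \bot\mid \varphi\to\varphi\mid\varphi\wedge\varphi\mid \varphi\veebar\varphi\mid \forall x\varphi\mid \bar\exists x\varphi$ ($\veebar$ inquisitive disjunction, $\bar\exists$ inquisitive existential); $\neg\varphi:=\varphi\to\bot$. $\varphi[z/x]$ is capture-avoiding substitution. Calculus $\mathbf{G}(\mathsf{FBInqBQ})$: a label is a nonempty finite subset of $\omega$; a labelled formula is $X:\varphi$ with $X$ a label; a sequent $\Gamma\Rightarrow\Delta$ is a pair of finite multisets of labelled formulas. $X,Y$ range over labels. Initial sequents: $(\mathtt{id})$ $X:P(\bar x),\Gamma\Rightarrow\Delta,Y:P(\bar x)$ whenever $X\supseteq Y$; $(\bot\Rightarrow)$ $X:\bot,\Gamma\Rightarrow\Delta$. Rules (premises / conclusion): $(\Rightarrow\mathtt{at})$: $\Gamma\Rightarrow\Delta,\{k\}:P(\bar x)$ for every $k\in X$ / $\Gamma\Rightarrow\Delta,X:P(\bar x)$. $(\Rightarrow\wedge)$: $\Gamma\Rightarrow\Delta,X:\varphi$ and $\Gamma\Rightarrow\Delta,X:\psi$ / $\Gamma\Rightarrow\Delta,X:\varphi\wedge\psi$.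 $(\wedge\Rightarrow)$: $X:\varphi,X:\psi,\Gamma\Rightarrow\Delta$ / $X:\varphi\wedge\psi,\Gamma\Rightarrow\Delta$. $(\Rightarrow\veebar)$: $\Gamma\Rightarrow\Delta,X:\varphi,X:\psi$ / $\Gamma\Rightarrow\Delta,X:\varphi\veebar\psi$. $(\veebar\Rightarrow)$: $X:\varphi,\Gamma\Rightarrow\Delta$ and $X:\psi,\Gamma\Rightarrow\Delta$ / $X:\varphi\veebar\psi,\Gamma\Rightarrow\Delta$. $(\Rightarrow\to)$: $Y:\varphi,\Gamma\Rightarrow\Delta,Y:\psi$ for every label $Y\subseteq X$ / $\Gamma\Rightarrow\Delta,X:\varphi\to\psi$. $(\to\Rightarrow)$, for a label $Y\subseteq X$: $X:\varphi\to\psi,\Gamma\Rightarrow\Delta,Y:\varphi$ and $Y:\psi,X:\varphi\to\psi,\Gamma\Rightarrow\Delta$ / $X:\varphi\to\psi,\Gamma\Rightarrow\Delta$. $(\Rightarrow\forall)$: $\Gamma\Rightarrow\Delta,X:\varphi[z/x]$ / $\Gamma\Rightarrow\Delta,X:\forall x\varphi$, with $z$ not occurring in the conclusion. $(\forall\Rightarrow)$: $X:\varphi[y/x],X:\forall x\varphi,\Gamma\Rightarrow\Delta$ / $X:\forall x\varphi,\Gamma\Rightarrow\Delta$ ($y$ arbitrary). $(\Rightarrow\bar\exists)$: $\Gamma\Rightarrow\Delta,X:\bar\exists x\varphi,X:\varphi[y/x]$ / $\Gamma\Rightarrow\Delta,X:\bar\exists x\varphi$ ($y$ arbitrary). $(\bar\exists\Rightarrow)$: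 $X:\varphi[z/x],\Gamma\Rightarrow\Delta$ / $X:\bar\exists x\varphi,\Gamma\Rightarrow\Delta$, with $z$ not occurring in the conclusion. A derivation is a finite tree of sequents built from initial sequents by these rules; a sequent is derivable if it is the root of a derivation. -}

module Defs where

open import Data.Nat using (ℕ; suc; _<_; _≡ᵇ_; _⊔_)
open import Data.Bool using (Bool; true; false; if_then_else_; not)
open import Data.List using (List; []; _∷_; _++_; map; filter; foldr; concatMap)
open import Data.Bool.ListAction using (any)
open import Data.List.Membership.Propositional using (_∈_)
open import Data.List.Relation.Unary.Linked using (Linked; [-])
open import Data.List.Relation.Binary.Permutation.Propositional using (_↭_)
open import Data.Vec using (Vec; toList) renaming (map to vmap)
open import Data.Product using (_×_; _,_)
open import Relation.Nullary using (¬_; ¬?)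
open import Relation.Nullary.Decidable using (⌊_⌋)
open import Data.Nat using (_≟_)

Var : Set
Var = ℕ

-- Predicate symbols of arity m are indexed by ℕ: the symbol is the pair (P , m).
PredSym : ℕ → Set
PredSym m = ℕ

infixr 5 _⇒_
infixr 6 _⩒_
infixr 7 _∧'_

data Fm : Set where
  atom : {m : ℕ} → PredSym m → Vec Var m → Fm
  ⊥'   : Fm
  _⇒_  : Fm → Fm → Fm
  _∧'_ : Fm → Fm → Fm
  _⩒_  : Fm → Fm → Fm          -- inquisitive disjunction
  all  : Var → Fm → Fm
  iex  : Var → Fm → Fm         -- inquisitive existential ∃̄ x φ

¬'_ : Fm → Fm
¬' φ = φ ⇒ ⊥'

fv : Fm → List Var
fv (atom P xs) = toList xs
fv ⊥' = []
fv (φ ⇒ ψ) = fv φ ++ fv ψ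
fv (φ ∧' ψ) = fv φ ++ fv ψ
fv (φ ⩒ ψ) = fv φ ++ fv ψ
fv (all x φ) = filter (λ u → ¬? (u ≟ x)) (fv φ)
fv (iex x φ) = filter (λ u → ¬? (u ≟ x)) (fv φ)

vars : Fm → List Var
vars (atom P xs) = toList xs
vars ⊥' = []
vars (φ ⇒ ψ) = vars φ ++ vars ψ
vars (φ ∧' ψ) = vars φ ++ vars ψ
vars (φ ⩒ ψ) = vars φ ++ vars ψ
vars (all x φ) = x ∷ vars φ
vars (iex x φ) = x ∷ vars φ

Sub : Set
Sub = Var → Var

upd : Sub → Var → Var → Sub
upd σ y w u = if u ≡ᵇ y then w else σ u

maxL : List ℕ → ℕ
maxL = foldr _⊔_ 0

-- the bound variable used when pushing σ under a binder y with body ψ: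
-- y itself unless some free variable of (binder y. ψ) is mapped to y by σ,
-- in which case a fresh variable (larger than everything relevant).
pick : Sub → Var → Fm → Var
pick σ y ψ =
  if any (λ u → σ u ≡ᵇ y) (filter (λ u → ¬? (u ≟ y)) (fv ψ))
  then suc (maxL (y ∷ vars ψ ++ map σ (fv ψ)))
  else y

sub : Sub → Fm → Fm
sub σ (atom P xs) = atom P (vmap σ xs)
sub σ ⊥' = ⊥'
sub σ (φ ⇒ ψ) = sub σ φ ⇒ sub σ ψ
sub σ (φ ∧' ψ) = sub σ φ ∧' sub σ ψ
sub σ (φ ⩒ ψ) = sub σ φ ⩒ sub σ ψ
sub σ (all y ψ) = all (pick σ y ψ) (sub (upd σ y (pick σ y ψ)) ψ)
sub σ (iex y ψ) = iex (pick σ y ψ) (sub (upd σ y (pick σ y ψ)) ψ)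

_[_/_] : Fm → Var → Var → Fm
φ [ z / x ] = sub (upd (λ u → u) x z) φ

-- Labels: nonempty finite subsets of ω, represented canonically as
-- strictly increasing nonempty lists.

record Label : Set where
  constructor lab
  field
    hd     : ℕ
    tl     : List ℕ
    sorted : Linked _<_ (hd ∷ tl)

elems : Label → List ℕ
elems X = Label.hd X ∷ Label.tl X

_⊆L_ : Label → Label → Set
Y ⊆L X = ∀ k → k ∈ elems Y → k ∈ elems X

single : ℕ → Label
single k = lab k [] [-]

LFm : Set
LFm = Label × Fm

Ctx : Set
Ctx = List LFm

varsCtx : Ctx → List Var
varsCtx = concatMap (λ { (X , φ) → vars φ })

-- The calculus G(FBInqBQ). Sequents are pairs of multisets, represented
-- as lists up to permutation (rule perm); principal formulas are at the head.

infix 3 _⊢_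

data _⊢_ : Ctx → Ctx → Set where
  perm : ∀ {Γ Γ' Δ Δ'} → Γ ↭ Γ' → Δ ↭ Δ' → Γ ⊢ Δ → Γ' ⊢ Δ'
  idA  : ∀ {Γ Δ X Y m} {P : PredSym m} {xs : Vec Var m} →
         Y ⊆L X → (X , atom P xs) ∷ Γ ⊢ (Y , atom P xs) ∷ Δ
  ⊥L   : ∀ {Γ Δ X} → (X , ⊥') ∷ Γ ⊢ Δ
  ⇒at  : ∀ {Γ Δ X m} {P : PredSym m} {xs : Vec Var m} →
         (∀ k → k ∈ elems X → Γ ⊢ (single k , atom P xs) ∷ Δ) →
         Γ ⊢ (X , atom P xs) ∷ Δ
  ⇒∧   : ∀ {Γ Δ X φ ψ} → Γ ⊢ (X , φ) ∷ Δ → Γ ⊢ (X , ψ) ∷ Δ →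
         Γ ⊢ (X , φ ∧' ψ) ∷ Δ
  ∧⇒   : ∀ {Γ Δ X φ ψ} → (X , φ) ∷ (X , ψ) ∷ Γ ⊢ Δ →
         (X , φ ∧' ψ) ∷ Γ ⊢ Δ
  ⇒⩒   : ∀ {Γ Δ X φ ψ} → Γ ⊢ (X , φ) ∷ (X , ψ) ∷ Δ →
         Γ ⊢ (X , φ ⩒ ψ) ∷ Δ
  ⩒⇒   : ∀ {Γ Δ X φ ψ} → (X , φ) ∷ Γ ⊢ Δ → (X , ψ) ∷ Γ ⊢ Δ →
         (X , φ ⩒ ψ) ∷ Γ ⊢ Δ
  ⇒→   : ∀ {Γ Δ X φ ψ} →
         (∀ Y → Y ⊆L X → (Y , φ) ∷ Γ ⊢ (Y , ψ) ∷ Δ) →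
         Γ ⊢ (X , φ ⇒ ψ) ∷ Δ
  →⇒   : ∀ {Γ Δ X Y φ ψ} → Y ⊆L X →
         (X , φ ⇒ ψ) ∷ Γ ⊢ (Y , φ) ∷ Δ →
         (Y , ψ) ∷ (X , φ ⇒ ψ) ∷ Γ ⊢ Δ →
         (X , φ ⇒ ψ) ∷ Γ ⊢ Δ
  ⇒∀   : ∀ {Γ Δ X x φ} z →
         ¬ (z ∈ (varsCtx Γ ++ varsCtx ((X , all x φ) ∷ Δ))) →
         Γ ⊢ (X , φ [ z / x ]) ∷ Δ →
         Γ ⊢ (X , all x φ) ∷ Δ
  ∀⇒   : ∀ {Γ Δ X x φ} y →
         (X , φ [ y / x ]) ∷ (X , all x φ) ∷ Γ ⊢ Δ →
         (X , all x φ) ∷ Γ ⊢ Δ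
  ⇒∃   : ∀ {Γ Δ X x φ} y →
         Γ ⊢ (X , iex x φ) ∷ (X , φ [ y / x ]) ∷ Δ →
         Γ ⊢ (X , iex x φ) ∷ Δ
  ∃⇒   : ∀ {Γ Δ X x φ} z →
         ¬ (z ∈ (varsCtx ((X , iex x φ) ∷ Γ) ++ varsCtx Δ)) →
         (X , φ [ z / x ]) ∷ Γ ⊢ Δ →
         (X , iex x φ) ∷ Γ ⊢ Δ

-- Apply (→⇒) to X : ¬θ → ∃̄xφ at the label Y of the points of X not yet covered, a point k
-- being covered once some W : θ with k ∈ W is in the antecedent: such a point refutes Z : ¬θ
-- for every Z ∋ k, via {k} : θ. The premise Y : ¬θ asks, for each W ⊆ Y, for the same sequent
-- with W : θ added, where the uncovered points Y ∖ W are strictly fewer. The premise Y : ∃̄xφ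
-- gives Y : φ[z/x] for a fresh z, and then X : ¬θ → φ[z/x] holds: a Z ⊆ X inside Y inherits
-- φ[z/x] from Y by persistence, and any other Z contains a covered point (θ[z/x] = θ since x
-- is not free in θ). Once every point is covered, any instance of the goal works.

{-# OPTIONS --safe #-}
module Submission where

open import Defs
open import Data.List using (List; []; _∷_; _++_; filter; length)
open import Data.List.Membership.Propositional using (_∈_; _∉_; find)
open import Data.Product using (_,_; ∃-syntax; _×_; proj₁; proj₂)
open import Relation.Nullary using (¬_; ¬?; yes; no)

open import Data.Bool using (Bool; false)
open import Data.Bool.ListAction using (any)
open import Data.Empty using (⊥-elim)
open import Data.Nat using (ℕ; suc; _+_; _<_; _≤_; s≤s; _≟_; _≡ᵇ_)
open import Data.Nat.Induction using (<-wellFounded)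
open import Data.Nat.Properties using (≤-trans; ≤-reflexive; m≤m+n; m≤n+m; m≤m⊔n; m≤n⊔m; 1+n≰n; <-trans)
open import Data.List.Properties using (filter-notAll)
open import Data.List.Membership.Propositional.Properties using (∈-++⁺ˡ; ∈-++⁺ʳ; ∈-filter⁻; ∈-filter⁺; ∈-∃++)
open import Data.List.Membership.DecPropositional _≟_ using (_∈?_)
open import Data.List.Relation.Unary.Any as Any using (here; there)
open import Data.List.Relation.Unary.All as All using (all?)
open import Data.List.Relation.Unary.All.Properties.Core using (¬All⇒Any¬)
open import Data.List.Relation.Unary.Linked using (Linked)
open import Data.List.Relation.Unary.Linked.Properties using (filter⁺)
open import Data.List.Relation.Binary.Permutation.Propositional using (refl; swap; ↭-sym)
open import Data.List.Relation.Binary.Permutation.Propositional.Properties using (shift)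
open import Data.Sum using (_⊎_; inj₁; inj₂)
open import Data.Vec using (Vec; toList) renaming (map to vmap; _∷_ to _∷ᵥ_; [] to []ᵥ)
open import Function using (_on_; case_of_)
open import Induction.WellFounded using (Acc; acc; WellFounded)
open import Relation.Binary.Construct.On as On using ()
open import Relation.Binary.PropositionalEquality using (_≡_; refl; cong; cong₂; trans)
open import Relation.Nullary.Decidable using (dec-true; dec-false)

size : Fm → ℕ
size (atom P xs) = 0
size ⊥' = 0
size (φ ⇒ ψ) = suc (size φ + size ψ)
size (φ ∧' ψ) = suc (size φ + size ψ)
size (φ ⩒ ψ) = suc (size φ + size ψ)
size (all x φ) = suc (size φ)
size (iex x φ) = suc (size φ)

size-sub : ∀ σ ψ → size (sub σ ψ) ≡ size ψ
size-sub σ (atom P xs) = refl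
size-sub σ ⊥' = refl
size-sub σ (φ ⇒ ψ) = cong₂ (λ a b → suc (a + b)) (size-sub σ φ) (size-sub σ ψ)
size-sub σ (φ ∧' ψ) = cong₂ (λ a b → suc (a + b)) (size-sub σ φ) (size-sub σ ψ)
size-sub σ (φ ⩒ ψ) = cong₂ (λ a b → suc (a + b)) (size-sub σ φ) (size-sub σ ψ)
size-sub σ (all y ψ) = cong suc (size-sub _ ψ)
size-sub σ (iex y ψ) = cong suc (size-sub _ ψ)

size-wellFounded : WellFounded (_<_ on size)
size-wellFounded = On.wellFounded size <-wellFounded

≤maxL : ∀ {n} ns → n ∈ ns → n ≤ maxL ns
≤maxL (m ∷ ns) (here refl) = m≤m⊔n m (maxL ns)
≤maxL (m ∷ ns) (there n∈ns) = ≤-trans (≤maxL ns n∈ns) (m≤n⊔m m (maxL ns))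

fresh : List Var → Var
fresh vs = suc (maxL vs)

fresh∉ : ∀ vs → fresh vs ∉ vs
fresh∉ vs p = 1+n≰n (≤maxL vs p)

Fixes : Sub → List Var → Set
Fixes σ vs = ∀ u → u ∈ vs → σ u ≡ u

fixesˡ : ∀ {σ} us vs → Fixes σ (us ++ vs) → Fixes σ us
fixesˡ us vs h u p = h u (∈-++⁺ˡ p)

fixesʳ : ∀ {σ} us vs → Fixes σ (us ++ vs) → Fixes σ vs
fixesʳ us vs h u p = h u (∈-++⁺ʳ us p)

vmap-fixes : ∀ {n} σ (xs : Vec Var n) → Fixes σ (toList xs) → vmap σ xs ≡ xs
vmap-fixes σ []ᵥ h = refl
vmap-fixes σ (x ∷ᵥ xs) h = cong₂ _∷ᵥ_ (h x (here refl)) (vmap-fixes σ xs (λ u p → h u (there p)))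

any-false : ∀ (p : Var → Bool) vs → (∀ u → u ∈ vs → p u ≡ false) → any p vs ≡ false
any-false p [] h = refl
any-false p (v ∷ vs) h rewrite h v (here refl) = any-false p vs (λ u q → h u (there q))

upd-≢ : ∀ σ {y w u} → ¬ u ≡ y → upd σ y w u ≡ σ u
upd-≢ σ {y} {u = u} u≢y rewrite dec-false (u ≟ y) u≢y = refl

fv-all-≢ : ∀ {u} y ψ → u ∈ fv (all y ψ) → ¬ u ≡ y
fv-all-≢ y ψ p = proj₂ (∈-filter⁻ (λ u → ¬? (u ≟ y)) {xs = fv ψ} p)

pick-fixes : ∀ σ y ψ → Fixes σ (fv (all y ψ)) → pick σ y ψ ≡ y
pick-fixes σ y ψ h
  rewrite any-false (λ u → σ u ≡ᵇ y) (fv (all y ψ))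
            (λ u p → trans (cong (_≡ᵇ y) (h u p)) (dec-false (u ≟ y) (fv-all-≢ y ψ p)))
  = refl

upd-fixes : ∀ σ y ψ → Fixes σ (fv (all y ψ)) → Fixes (upd σ y y) (fv ψ)
upd-fixes σ y ψ h u p with u ≟ y
... | yes refl rewrite dec-true (u ≟ u) refl = refl
... | no u≢y = trans (upd-≢ σ u≢y) (h u (∈-filter⁺ (λ u → ¬? (u ≟ y)) p u≢y))

sub-fixes : ∀ σ ψ → Fixes σ (fv ψ) → sub σ ψ ≡ ψ
sub-fixes σ (atom P xs) h = cong (atom P) (vmap-fixes σ xs h)
sub-fixes σ ⊥' h = refl
sub-fixes σ (φ ⇒ ψ) h =
  cong₂ _⇒_ (sub-fixes σ φ (fixesˡ (fv φ) (fv ψ) h)) (sub-fixes σ ψ (fixesʳ (fv φ) (fv ψ) h))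
sub-fixes σ (φ ∧' ψ) h =
  cong₂ _∧'_ (sub-fixes σ φ (fixesˡ (fv φ) (fv ψ) h)) (sub-fixes σ ψ (fixesʳ (fv φ) (fv ψ) h))
sub-fixes σ (φ ⩒ ψ) h =
  cong₂ _⩒_ (sub-fixes σ φ (fixesˡ (fv φ) (fv ψ) h)) (sub-fixes σ ψ (fixesʳ (fv φ) (fv ψ) h))
sub-fixes σ (all y ψ) h rewrite pick-fixes σ y ψ h =
  cong (all y) (sub-fixes (upd σ y y) ψ (upd-fixes σ y ψ h))
sub-fixes σ (iex y ψ) h rewrite pick-fixes σ y ψ h =
  cong (iex y) (sub-fixes (upd σ y y) ψ (upd-fixes σ y ψ h))

[/]-nonfree : ∀ θ x z → x ∉ fv θ → θ [ z / x ] ≡ θ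
[/]-nonfree θ x z x∉θ = sub-fixes _ θ (λ u u∈θ → upd-≢ (λ u → u) λ { refl → x∉θ u∈θ })

⊆L-refl : ∀ {X} → X ⊆L X
⊆L-refl k k∈X = k∈X

⊆L-trans : ∀ {X Y Z} → Z ⊆L Y → Y ⊆L X → Z ⊆L X
⊆L-trans Z⊆Y Y⊆X k k∈Z = Y⊆X k (Z⊆Y k k∈Z)

single-⊆L : ∀ {k X} → k ∈ elems X → single k ⊆L X
single-⊆L k∈X _ (here refl) = k∈X

exchangeˡ : ∀ {A B Γ Δ} → A ∷ B ∷ Γ ⊢ Δ → B ∷ A ∷ Γ ⊢ Δ
exchangeˡ = perm (swap _ _ refl) refl

exchangeʳ : ∀ {A B Γ Δ} → Γ ⊢ A ∷ B ∷ Δ → Γ ⊢ B ∷ A ∷ Δ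
exchangeʳ = perm refl (swap _ _ refl)

id-acc : ∀ ψ → Acc (_<_ on size) ψ → ∀ {Γ Δ X Y} → Y ⊆L X → (X , ψ) ∷ Γ ⊢ (Y , ψ) ∷ Δ
id-acc (atom P xs) _ Y⊆X = idA Y⊆X
id-acc ⊥' _ Y⊆X = ⊥L
id-acc (φ ⇒ ψ) (acc rs) {X = X} {Y} Y⊆X =
  ⇒→ λ Z Z⊆Y → exchangeˡ
    (→⇒ {X = X} {Y = Z} (⊆L-trans {X} {Y} {Z} Z⊆Y Y⊆X)
      (exchangeˡ (id-acc φ (rs (s≤s (m≤m+n _ _))) (⊆L-refl {Z})))
      (id-acc ψ (rs (s≤s (m≤n+m _ _))) (⊆L-refl {Z})))
id-acc (φ ∧' ψ) (acc rs) Y⊆X =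
  ⇒∧ (∧⇒ (id-acc φ (rs (s≤s (m≤m+n _ _))) Y⊆X))
     (∧⇒ (exchangeˡ (id-acc ψ (rs (s≤s (m≤n+m _ _))) Y⊆X)))
id-acc (φ ⩒ ψ) (acc rs) Y⊆X =
  ⇒⩒ (⩒⇒ (id-acc φ (rs (s≤s (m≤m+n _ _))) Y⊆X)
          (exchangeʳ (id-acc ψ (rs (s≤s (m≤n+m _ _))) Y⊆X)))
id-acc (all x ψ) (acc rs) {Γ} {Δ} {X} {Y} Y⊆X =
  ⇒∀ z (fresh∉ _) (∀⇒ z (id-acc (ψ [ z / x ]) (rs (s≤s (≤-reflexive (size-sub _ ψ)))) Y⊆X))
  where z = fresh (varsCtx ((X , all x ψ) ∷ Γ) ++ varsCtx ((Y , all x ψ) ∷ Δ))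
id-acc (iex x ψ) (acc rs) {Γ} {Δ} {X} {Y} Y⊆X =
  ∃⇒ z (fresh∉ _)
     (⇒∃ z (exchangeʳ (id-acc (ψ [ z / x ]) (rs (s≤s (≤-reflexive (size-sub _ ψ)))) Y⊆X)))
  where z = fresh (varsCtx ((X , iex x ψ) ∷ Γ) ++ varsCtx ((Y , iex x ψ) ∷ Δ))

id-∈ : ∀ {Γ Δ X Y ψ} → (X , ψ) ∈ Γ → Y ⊆L X → Γ ⊢ (Y , ψ) ∷ Δ
id-∈ {ψ = ψ} X:ψ∈Γ Y⊆X with Γ₁ , Γ₂ , refl ← ∈-∃++ X:ψ∈Γ =
  perm (↭-sym (shift _ Γ₁ Γ₂)) refl (id-acc ψ (size-wellFounded ψ) Y⊆X)

overlap-refutes-¬ : ∀ {Γ Δ W Z k θ} → (W , θ) ∈ Γ → k ∈ elems W → k ∈ elems Z → (Z , ¬' θ) ∷ Γ ⊢ Δ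
overlap-refutes-¬ {W = W} {Z} {k} W:θ∈Γ k∈W k∈Z =
  →⇒ {Y = single k} (single-⊆L {X = Z} k∈Z) (id-∈ (there W:θ∈Γ) (single-⊆L {X = W} k∈W)) ⊥L

⊆-or-∉ : ∀ xs ys → (∀ k → k ∈ xs → k ∈ ys) ⊎ ∃[ k ] k ∈ xs × k ∉ ys
⊆-or-∉ xs ys with all? (_∈? ys) xs
... | yes xs⊆ys = inj₁ λ k → All.lookup xs⊆ys
... | no xs⊈ys = inj₂ (find (¬All⇒Any¬ (_∈? ys) xs xs⊈ys))

_∖_ : List ℕ → Label → List ℕ
ys ∖ W = filter (λ k → ¬? (k ∈? elems W)) ys

∖-⊆ : ∀ {k} ys W → k ∈ ys ∖ W → k ∈ ys
∖-⊆ ys W p = proj₁ (∈-filter⁻ (λ k → ¬? (k ∈? elems W)) {xs = ys} p)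

∖-sorted : ∀ ys W → Linked _<_ ys → Linked _<_ (ys ∖ W)
∖-sorted ys W = filter⁺ (λ k → ¬? (k ∈? elems W)) <-trans

∖-shrinks : ∀ ys W → Label.hd W ∈ ys → length (ys ∖ W) < length ys
∖-shrinks ys W hd∈ys =
  filter-notAll (λ k → ¬? (k ∈? elems W)) ys (Any.map (λ { refl k∉W → k∉W (here refl) }) hd∈ys)

module Covering (X : Label) (θ : Fm) where

  Covers : Ctx → List ℕ → Set
  Covers Γ Y = ∀ k → k ∈ elems X → k ∈ Y ⊎ ∃[ W ] (W , θ) ∈ Γ × k ∈ elems W

  covers-weaken : ∀ {Γ Y} A → Covers Γ Y → Covers (A ∷ Γ) Y
  covers-weaken A cov k k∈X with cov k k∈X
  ... | inj₁ k∈Y = inj₁ k∈Y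
  ... | inj₂ (W , W:θ∈Γ , k∈W) = inj₂ (W , there W:θ∈Γ , k∈W)

  covers-∖ : ∀ {Γ Y} W → Covers Γ Y → Covers ((W , θ) ∷ Γ) (Y ∖ W)
  covers-∖ W cov k k∈X with covers-weaken (W , θ) cov k k∈X
  ... | inj₂ covered = inj₂ covered
  ... | inj₁ k∈Y with k ∈? elems W
  ...   | yes k∈W = inj₂ (W , here refl , k∈W)
  ...   | no k∉W = inj₁ (∈-filter⁺ (λ k → ¬? (k ∈? elems W)) k∈Y k∉W)

module _ (X : Label) (x : Var) (φ θ : Fm) (x∉θ : x ∉ fv θ) where

  open Covering X θ

  ⇒∃¬θ→ : ∀ {Γ Δ Y} y → Covers Γ Y →
          (∀ Z → Z ⊆L X → (∀ k → k ∈ elems Z → k ∈ Y) →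
             (Z , ¬' θ) ∷ Γ ⊢ (Z , φ [ y / x ]) ∷ (X , iex x (¬' θ ⇒ φ)) ∷ Δ) →
          Γ ⊢ (X , iex x (¬' θ ⇒ φ)) ∷ Δ
  ⇒∃¬θ→ {Γ} {Δ} {Y} y cov inside = ⇒∃ y (exchangeʳ (⇒→ forces))
    where
      forces : ∀ Z → Z ⊆L X →
               (Z , θ [ y / x ] ⇒ ⊥') ∷ Γ ⊢ (Z , φ [ y / x ]) ∷ (X , iex x (¬' θ ⇒ φ)) ∷ Δ
      forces Z Z⊆X rewrite [/]-nonfree θ x y x∉θ with ⊆-or-∉ (elems Z) Y
      ... | inj₁ Z⊆Y = inside Z Z⊆X Z⊆Y
      ... | inj₂ (k , k∈Z , k∉Y) with cov k (Z⊆X k k∈Z)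
      ...   | inj₁ k∈Y = ⊥-elim (k∉Y k∈Y)
      ...   | inj₂ (W , W:θ∈Γ , k∈W) = overlap-refutes-¬ W:θ∈Γ k∈W k∈Z

  derivable-from-cover : ∀ Y → Acc (_<_ on length) Y → Linked _<_ Y →
                         (∀ k → k ∈ Y → k ∈ elems X) → ∀ {Γ Δ} → Covers Γ Y →
                         (X , ¬' θ ⇒ iex x φ) ∷ Γ ⊢ (X , iex x (¬' θ ⇒ φ)) ∷ Δ
  derivable-from-cover [] _ _ _ cov =
    ⇒∃¬θ→ x (covers-weaken _ cov) λ Z _ Z⊆[] → case Z⊆[] _ (here refl) of λ ()
  derivable-from-cover (h ∷ t) (acc rs) sorted Y⊆X {Γ} {Δ} cov =
    →⇒ {Y = Yₗ} Y⊆X refute-Yₗ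
      (∃⇒ z (fresh∉ _) (⇒∃¬θ→ z (covers-weaken _ (covers-weaken _ cov))
        λ Z _ Z⊆Yₗ → id-∈ (there (here refl)) Z⊆Yₗ))
    where
      Yₗ = lab h t sorted
      z = fresh (varsCtx ((Yₗ , iex x φ) ∷ (X , ¬' θ ⇒ iex x φ) ∷ Γ)
                 ++ varsCtx ((X , iex x (¬' θ ⇒ φ)) ∷ Δ))
      refute-Yₗ : (X , ¬' θ ⇒ iex x φ) ∷ Γ ⊢ (Yₗ , ¬' θ) ∷ (X , iex x (¬' θ ⇒ φ)) ∷ Δ
      refute-Yₗ = ⇒→ λ W W⊆Yₗ → exchangeˡ (exchangeʳ
        (derivable-from-cover ((h ∷ t) ∖ W) (rs (∖-shrinks (h ∷ t) W (W⊆Yₗ _ (here refl))))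
          (∖-sorted (h ∷ t) W sorted) (λ k p → Y⊆X k (∖-⊆ (h ∷ t) W p)) (covers-∖ W cov)))

proposition10 : (X : Label) (x : Var) (φ θ : Fm) → ¬ (x ∈ fv θ) →
    (X , (¬' θ) ⇒ iex x φ) ∷ [] ⊢ (X , iex x ((¬' θ) ⇒ φ)) ∷ []
proposition10 X x φ θ x∉θ =
  derivable-from-cover X x φ θ x∉θ (elems X) (On.wellFounded length <-wellFounded (elems X))
    (Label.sorted X) (λ k k∈X → k∈X) (λ k k∈X → inj₁ k∈X)
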